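{- Let $r\in \mathbb{N}$ with $r\geq 3$ and let $\gamma>0$. Let $\mathcal{P}=\{U^1, \dots, U^k\}$ be a $k$-partition of the vertex set $V=(V_1, \dots, V_r)$ with $|V_1|=\dots=|V_r|=n$. Let $H$ be any $K_r$-divisible graph on $V$ such that $|d_H(v, U^i_{j_1})-d_H(v, U^i_{j_2})|<\gamma n$ for all $1\leq i \leq k$, all $1\leq j_1, j_2\leq r$ and all $v\notin V_{j_1}\cup V_{j_2}$. Then the excess multigraph $\mathrm{EM}(H)$ has a decomposition into at most $3\gamma k^2r^2n^2$ irreducible $K_r$-divisible multigraphs.
   Context: For $U\subseteq V$, $U_j:=U\cap V_j$. A $k$-partition of $V$ is a partition $\{U^1,\dots,U^k\}$ such that for each $j$, $\{U^i_j:1\le i\le k\}$ is an equitable partition of $V_j$, and for each $i$, $|U^i_1|=\dots=|U^i_r|$. A (multi)graph $F$ on $(W_1,\dots,W_r)$ (or on $V$) is $K_r$-divisible if it is $r$-partite with these classes and, counting edges with multiplicity, $d_F(v,W_{j_1})=d_F(v,W_{j_2})$ for all $j_1,j_2$ and all $v\notin W_{j_1}\cup W_{j_2}$. A $K_r$-divisible multigraph $F$ is irreducible if no $F'\subsetneq F$ with $e(F')>0$ is $K_r$-divisible. Excess multigraph: let $K$ be a copy of the complete $r$-partite graph $K_r(k)$ with classes $W_j=\{w^1_j,\dots,w^k_j\}$, $1\le j\le r$. $\mathrm{EM}(H)$ is the multigraph on $V(K)$ in which, for each edge $w^{i_1}_{j_1}w^{i_2}_{j_2}$ of $K$ (so $j_1\ne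 j_2$), there are exactly $e_H(U^{i_1}_{j_1},U^{i_2}_{j_2})-\min\{e_H(U^{i_1}_j,U^{i_2}_{j'}):1\le j,j'\le r, j\ne j'\}$ parallel edges between $w^{i_1}_{j_1}$ and $w^{i_2}_{j_2}$. A decomposition of a multigraph is a partition of its edge multiset into submultigraphs. -}

module Defs where

open import Data.Nat using (ℕ; zero; suc; _+_; _*_; _∸_; _≤_; ∣_-_∣)
open import Data.Nat.Properties using (_≟_)
open import Data.Fin using (Fin)
import Data.Fin.Properties as FinP
open import Data.Bool using (Bool; true; false; if_then_else_; _∧_)
open import Data.Product using (Σ; _×_; _,_; proj₁; proj₂; ∃-syntax)
import Data.List
open import Data.List using (List; []; _∷_; length; map; foldr)
open import Data.List.Relation.Unary.All using (All)
open import Relation.Binary.PropositionalEquality using (_≡_; _≢_)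
open import Relation.Nullary using (¬_; does)
open import Data.Integer using (+_)
open import Data.Rational using (ℚ; _/_)

∑ : (m : ℕ) → (Fin m → ℕ) → ℕ
∑ zero    f = 0
∑ (suc m) f = f Fin.zero + ∑ m (λ x → f (Fin.suc x))

[_] : Bool → ℕ
[ b ] = if b then 1 else 0

ℕ→ℚ : ℕ → ℚ
ℕ→ℚ m = (+ m) / 1

-- The vertex set V = (V_1,…,V_r), |V_j| = n.
-- A vertex (j , x) is the x-th vertex of class V_j.

Vtx : ℕ → ℕ → Set
Vtx r n = Fin r × Fin n

record Graph (r n : ℕ) : Set where
  field
    adj   : Vtx r n → Vtx r n → Bool
    sym   : ∀ u v → adj u v ≡ adj v u
    irrfl : ∀ v → adj v v ≡ false
open Graph public

-- A k-partition P = {U^1,…,U^k} of V, given by the map assigning to each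
-- vertex the index i of the part U^i containing it.
-- U^i_j = U^i ∩ V_j.

partSize : ∀ {r n k} → (Vtx r n → Fin k) → Fin k → Fin r → ℕ
partSize {r} {n} P i j = ∑ n (λ x → [ does (P (j , x) FinP.≟ i) ])

record IsKPartition (r n k : ℕ) (P : Vtx r n → Fin k) : Set where
  field
    equitable : ∀ j i₁ i₂ → partSize P i₁ j ≤ partSize P i₂ j + 1
    balanced  : ∀ i j₁ j₂ → partSize P i j₁ ≡ partSize P i j₂

degPart : ∀ {r n k} → Graph r n → (Vtx r n → Fin k) → Vtx r n → Fin k → Fin r → ℕ
degPart {r} {n} H P v i j =
  ∑ n (λ x → [ does (P (j , x) FinP.≟ i) ∧ adj H v (j , x) ])

degClass : ∀ {r n} → Graph r n → Vtx r n → Fin r → ℕ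
degClass {r} {n} H v j = ∑ n (λ x → [ adj H v (j , x) ])

record IsKrDivisibleGraph {r n : ℕ} (H : Graph r n) : Set where
  field
    rpartite : ∀ j x y → adj H (j , x) (j , y) ≡ false
    divisible : ∀ (v : Vtx r n) j₁ j₂ → proj₁ v ≢ j₁ → proj₁ v ≢ j₂ →
                degClass H v j₁ ≡ degClass H v j₂

-- e_H(U^{i₁}_{j₁}, U^{i₂}_{j₂})  (used only for j₁ ≠ j₂, so the two sets
-- are disjoint and each edge is counted once)
edgesBetween : ∀ {r n k} → Graph r n → (Vtx r n → Fin k) →
               Fin k → Fin r → Fin k → Fin r → ℕ
edgesBetween {r} {n} H P i₁ j₁ i₂ j₂ =
  ∑ n (λ x → ∑ n (λ y →
    [ does (P (j₁ , x) FinP.≟ i₁) ∧ does (P (j₂ , y) FinP.≟ i₂)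
      ∧ adj H (j₁ , x) (j₂ , y) ]))

-- Multigraphs on W = (W_1,…,W_r) with W_j = {w^1_j,…,w^k_j}.
-- The vertex w^i_j is (j , i).  A multigraph is a symmetric
-- edge-multiplicity function.

Wtx : ℕ → ℕ → Set
Wtx r k = Fin r × Fin k

record MultiGraph (r k : ℕ) : Set where
  field
    mult : Wtx r k → Wtx r k → ℕ
    msym : ∀ u v → mult u v ≡ mult v u
open MultiGraph public

mdeg : ∀ {r k} → MultiGraph r k → Wtx r k → Fin r → ℕ
mdeg {r} {k} F v j = ∑ k (λ i → mult F v (j , i))

record IsKrDivisible {r k : ℕ} (F : MultiGraph r k) : Set where
  field
    rpartite  : ∀ j i₁ i₂ → mult F (j , i₁) (j , i₂) ≡ 0
    divisible : ∀ (v : Wtx r k) j₁ j₂ → proj₁ v ≢ j₁ → proj₁ v ≢ j₂ →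
                mdeg F v j₁ ≡ mdeg F v j₂

-- number of edges e(F) (each edge counted once, with multiplicity)
-- We express e(F) > 0 as: some pair has positive multiplicity.
HasEdge : ∀ {r k} → MultiGraph r k → Set
HasEdge F = ∃[ u ] ∃[ v ] (0 Data.Nat.< mult F u v)
  where import Data.Nat

_⊊_ : ∀ {r k} → MultiGraph r k → MultiGraph r k → Set
F' ⊊ F = (∀ u v → mult F' u v ≤ mult F u v) × ¬ (∀ u v → mult F' u v ≡ mult F u v)

IsIrreducible : ∀ {r k} → MultiGraph r k → Set
IsIrreducible {r} {k} F =
  ∀ (F' : MultiGraph r k) → F' ⊊ F → HasEdge F' → ¬ IsKrDivisible F'

-- minimum of a list of naturals (the empty list is never used here:
-- for r ≥ 2 there are pairs j ≠ j'; we set it to 0 for totality)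
minList : List ℕ → ℕ
minList []           = 0
minList (x ∷ [])     = x
minList (x ∷ y ∷ xs) = x Data.Nat.⊓ minList (y ∷ xs)
  where import Data.Nat

offDiag : (r : ℕ) → (Fin r → Fin r → ℕ) → List ℕ
offDiag r g = concatMap (λ j → concatMap (λ j' →
                if does (j FinP.≟ j') then [] else (g j j' ∷ []))
                (allFin r)) (allFin r)
  where open Data.List using (concatMap; allFin)

minOffDiag : (r : ℕ) → (Fin r → Fin r → ℕ) → ℕ
minOffDiag r g = minList (offDiag r g)

-- multiplicity of the edge w^{i₁}_{j₁} w^{i₂}_{j₂} in EM(H)
-- (0 when j₁ = j₂, as there is no such edge in K_r(k))
emMult : ∀ {r n k} → Graph r n → (Vtx r n → Fin k) → Wtx r k → Wtx r k → ℕ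
emMult {r} H P (j₁ , i₁) (j₂ , i₂) =
  if does (j₁ FinP.≟ j₂) then 0
  else (edgesBetween H P i₁ j₁ i₂ j₂
        ∸ minOffDiag r (λ j j' → edgesBetween H P i₁ j i₂ j'))

sumList : List ℕ → ℕ
sumList = foldr _+_ 0

-- Write e(i₁,j₁,i₂,j₂) = e_H(U^{i₁}_{j₁}, U^{i₂}_{j₂}).  It is a sum, over the at most n vertices
-- of U^{i₁}_{j₁}, of their degrees into U^{i₂}_{j₂}; so by the hypothesis, replacing j₂ (or, by
-- symmetry, j₁) by another class changes it by less than γn².  As r ≥ 3, any ordered pair of
-- distinct classes turns into any other by at most three such replacements, hence every
-- multiplicity of EM(H) is below 3γn².  EM(H) is K_r-divisible because H is and the subtracted
-- minimum depends only on (i₁, i₂).  A K_r-divisible multigraph with an edge contains an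
-- irreducible K_r-divisible submultigraph (irreducibility is decidable by a bounded search);
-- removing it and repeating yields at most Σ_{u,w} mult(u,w) ≤ (kr)² · 3γn² pieces.
module Submission where

open import Defs hiding (sym)
open import Data.Nat using (ℕ; _≥_; _*_; _^_; ∣_-_∣)
open import Data.Fin using (Fin)
open import Data.Product using (Σ; _×_; _,_; proj₁)
open import Data.List using (List; length; map)
open import Data.List.Relation.Unary.All using (All)
open import Relation.Binary.PropositionalEquality using (_≡_; _≢_)
open import Data.Rational using (ℚ; Positive) renaming (_<_ to _<ℚ_; _≤_ to _≤ℚ_; _*_ to _*ℚ_)

open import Data.Nat using (zero; suc; _+_; _∸_; _≤_; _<_; z≤n; s≤s)
open import Data.Nat.Properties
open import Data.Nat.Tactic.RingSolver using (solve-∀)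
open import Algebra.Properties.CommutativeSemigroup +-commutativeSemigroup using (interchange)
open import Data.Fin using (zero; suc; toℕ; fromℕ<; punchIn; punchOut; combine; remQuot)
open import Data.Fin.Properties as FinP
  using (punchInᵢ≢i; punchIn-punchOut; punchIn-injective; toℕ≤pred[n]; toℕ-fromℕ<; remQuot-combine)
import Data.Vec.Functional as Vector
open import Data.Bool using (Bool; true; false; _∧_; if_then_else_)
open import Data.Bool.Properties using (∧-assoc; ∧-comm)
open import Data.Product using (∃; ∃₂; proj₂; uncurry)
import Data.Product as Σ
open import Data.Sum using (inj₁; inj₂)
open import Data.Empty using (⊥-elim)
open import Relation.Nullary using (Dec; yes; no; does)
open import Relation.Nullary.Decidable using (_×-dec_; ¬?; _→-dec_; map′)
open import Relation.Binary.PropositionalEquality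
  using (refl; sym; trans; ≢-sym; cong; cong₂; subst; subst₂; module ≡-Reasoning)
open import Data.List using ([]; _∷_)
import Data.List.Relation.Unary.All as All
import Data.List.Relation.Unary.All.Properties as AllP
import Data.List.Relation.Unary.Any.Properties as AnyP
open import Data.List.Relation.Unary.Any using (here; there)
open import Data.List.Membership.Propositional using (_∈_)
import Data.Integer as ℤ
import Data.Integer.Properties as ℤP

open import Data.Rational using (mkℚ; toℚᵘ)
import Data.Rational.Properties as ℚP
import Data.Rational.Unnormalised as ℚᵘ
import Data.Rational.Unnormalised.Properties as ℚᵘP
open import Data.Nat.Coprimality using (Coprime)

∑-cong : ∀ m {f g : Fin m → ℕ} → (∀ x → f x ≡ g x) → ∑ m f ≡ ∑ m g
∑-cong zero    f≡g = refl
∑-cong (suc m) f≡g = cong₂ _+_ (f≡g zero) (∑-cong m (λ x → f≡g (suc x)))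

∑-mono-≤ : ∀ m {f g : Fin m → ℕ} → (∀ x → f x ≤ g x) → ∑ m f ≤ ∑ m g
∑-mono-≤ zero    f≤g = z≤n
∑-mono-≤ (suc m) f≤g = +-mono-≤ (f≤g zero) (∑-mono-≤ m (λ x → f≤g (suc x)))

∑-zero : ∀ m → ∑ m (λ _ → 0) ≡ 0
∑-zero zero    = refl
∑-zero (suc m) = ∑-zero m

∑-≤-* : ∀ m {f : Fin m → ℕ} c → (∀ x → f x ≤ c) → ∑ m f ≤ m * c
∑-≤-* zero    c f≤c = z≤n
∑-≤-* (suc m) c f≤c = +-mono-≤ (f≤c zero) (∑-≤-* m c (λ x → f≤c (suc x)))

term≤∑ : ∀ m (f : Fin m → ℕ) x → f x ≤ ∑ m f
term≤∑ (suc m) f zero    = m≤m+n _ _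
term≤∑ (suc m) f (suc x) = ≤-trans (term≤∑ m (λ y → f (suc y)) x) (m≤n+m _ _)

∑-distrib-+ : ∀ m (f g : Fin m → ℕ) → ∑ m (λ x → f x + g x) ≡ ∑ m f + ∑ m g
∑-distrib-+ zero    f g = refl
∑-distrib-+ (suc m) f g =
  trans (cong ((f zero + g zero) +_) (∑-distrib-+ m (λ x → f (suc x)) (λ x → g (suc x))))
        (interchange (f zero) (g zero) _ _)

∑-distribˡ-* : ∀ m c (f : Fin m → ℕ) → ∑ m (λ x → c * f x) ≡ c * ∑ m f
∑-distribˡ-* zero    c f = sym (*-zeroʳ c)
∑-distribˡ-* (suc m) c f =
  trans (cong (c * f zero +_) (∑-distribˡ-* m c (λ x → f (suc x))))
        (sym (*-distribˡ-+ c (f zero) _))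

∑-distribʳ-* : ∀ m c (f : Fin m → ℕ) → ∑ m (λ x → f x * c) ≡ ∑ m f * c
∑-distribʳ-* m c f =
  trans (∑-cong m (λ x → *-comm (f x) c)) (trans (∑-distribˡ-* m c f) (*-comm c _))

∑-comm : ∀ m n (f : Fin m → Fin n → ℕ) →
         ∑ m (λ x → ∑ n (f x)) ≡ ∑ n (λ y → ∑ m (λ x → f x y))
∑-comm zero    n f = sym (∑-zero n)
∑-comm (suc m) n f =
  trans (cong (∑ n (f zero) +_) (∑-comm m n (λ x → f (suc x))))
        (sym (∑-distrib-+ n (f zero) _))

∑-distrib-∸ : ∀ m (f g : Fin m → ℕ) → (∀ x → g x ≤ f x) →
              ∑ m (λ x → f x ∸ g x) ≡ ∑ m f ∸ ∑ m g
∑-distrib-∸ m f g g≤f = begin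
  ∑ m (λ x → f x ∸ g x)                         ≡⟨ sym (m+n∸n≡m _ (∑ m g)) ⟩
  ∑ m (λ x → f x ∸ g x) + ∑ m g ∸ ∑ m g         ≡⟨ cong (_∸ ∑ m g) (sym (∑-distrib-+ m _ g)) ⟩
  ∑ m (λ x → f x ∸ g x + g x) ∸ ∑ m g           ≡⟨ cong (_∸ ∑ m g) (∑-cong m (λ x → m∸n+n≡m (g≤f x))) ⟩
  ∑ m f ∸ ∑ m g                                 ∎
  where open ≡-Reasoning

∑-≡⇒≡ : ∀ m (f g : Fin m → ℕ) → (∀ x → f x ≤ g x) → ∑ m f ≡ ∑ m g → ∀ x → f x ≡ g x
∑-≡⇒≡ m f g f≤g ∑f≡∑g x = ≤-antisym (f≤g x) (m∸n≡0⇒m≤n (n≤0⇒n≡0 (begin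
  g x ∸ f x                 ≤⟨ term≤∑ m (λ y → g y ∸ f y) x ⟩
  ∑ m (λ y → g y ∸ f y)     ≡⟨ ∑-distrib-∸ m g f f≤g ⟩
  ∑ m g ∸ ∑ m f             ≡⟨ cong (∑ m g ∸_) ∑f≡∑g ⟩
  ∑ m g ∸ ∑ m g             ≡⟨ n∸n≡0 (∑ m g) ⟩
  0                         ∎)))
  where open ≤-Reasoning

[∧]≡* : ∀ a b → [ a ∧ b ] ≡ [ a ] * [ b ]
[∧]≡* true  b = sym (+-identityʳ _)
[∧]≡* false b = refl

∑-[≟∧] : ∀ k (c : Fin k) b → ∑ k (λ i → [ does (c FinP.≟ i) ∧ b ]) ≡ [ b ]
∑-[≟∧] (suc k) zero    b = trans (cong ([ b ] +_) (∑-zero k)) (+-identityʳ _)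
∑-[≟∧] (suc k) (suc c) b = ∑-[≟∧] k c b

minList-≤ : ∀ xs → All (minList xs ≤_) xs
minList-≤ []           = All.[]
minList-≤ (x ∷ [])     = ≤-refl All.∷ All.[]
minList-≤ (x ∷ y ∷ xs) =
  m⊓n≤m x _ All.∷ All.map (≤-trans (m⊓n≤n x _)) (minList-≤ (y ∷ xs))

minList-∈ : ∀ x xs → minList (x ∷ xs) ∈ x ∷ xs
minList-∈ x []       = here refl
minList-∈ x (y ∷ ys) with ⊓-sel x (minList (y ∷ ys))
... | inj₁ x⊓m≡x = here x⊓m≡x
... | inj₂ x⊓m≡m = there (subst (_∈ y ∷ ys) (sym x⊓m≡m) (minList-∈ y ys))

∈⇒minList-∈ : ∀ {x xs} → x ∈ xs → minList xs ∈ xs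
∈⇒minList-∈ {xs = y ∷ ys} _ = minList-∈ y ys

OffDiagonalValue : (r : ℕ) → (Fin r → Fin r → ℕ) → ℕ → Set
OffDiagonalValue r g v = ∃₂ λ j j' → j ≢ j' × v ≡ g j j'

offDiag-offDiagonal : ∀ r g → All (OffDiagonalValue r g) (offDiag r g)
offDiag-offDiagonal r g =
  AllP.concat⁺ (AllP.map⁺ (AllP.tabulate⁺ λ j → AllP.concat⁺ (AllP.map⁺ (AllP.tabulate⁺ (entry j)))))
  where
  entry : ∀ j j' → All (OffDiagonalValue r g) (if does (j FinP.≟ j') then [] else (g j j' ∷ []))
  entry j j' with j FinP.≟ j'
  ... | yes _   = All.[]
  ... | no j≢j' = (j , j' , j≢j' , refl) All.∷ All.[]

∈-offDiag : ∀ r g {j j'} → j ≢ j' → g j j' ∈ offDiag r g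
∈-offDiag r g {j} {j'} j≢j' =
  AnyP.concat⁺ (AnyP.map⁺ (AnyP.tabulate⁺ j (AnyP.concat⁺ (AnyP.map⁺ (AnyP.tabulate⁺ j' entry)))))
  where
  entry : g j j' ∈ (if does (j FinP.≟ j') then [] else (g j j' ∷ []))
  entry with j FinP.≟ j'
  ... | yes j≡j' = ⊥-elim (j≢j' j≡j')
  ... | no _     = here refl

minOffDiag-≤ : ∀ r g {j j'} → j ≢ j' → minOffDiag r g ≤ g j j'
minOffDiag-≤ r g j≢j' = All.lookup (minList-≤ (offDiag r g)) (∈-offDiag r g j≢j')

-- j ≢ j' serves only to make the list of off-diagonal values nonempty.
minOffDiag-attained : ∀ r g {j j' : Fin r} → j ≢ j' → OffDiagonalValue r g (minOffDiag r g)
minOffDiag-attained r g j≢j' = All.lookup (offDiag-offDiagonal r g) (∈⇒minList-∈ (∈-offDiag r g j≢j'))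

avoid-two : ∀ {r} → r ≥ 3 → (a c : Fin r) → ∃ λ e → e ≢ a × e ≢ c
avoid-two {suc (suc (suc m))} (s≤s (s≤s (s≤s _))) a c with c FinP.≟ a
... | yes refl = punchIn a zero , punchInᵢ≢i a zero , punchInᵢ≢i a zero
... | no c≢a   = punchIn a (punchIn c' zero) , punchInᵢ≢i a _ , e≢c
  where
  c' : Fin (suc (suc m))
  c' = punchOut (≢-sym c≢a)
  e≢c : punchIn a (punchIn c' zero) ≢ c
  e≢c e≡c = punchInᵢ≢i c' zero
    (punchIn-injective a _ _ (trans e≡c (sym (punchIn-punchOut (≢-sym c≢a)))))

three-steps : ∀ {x y z w c} → x ≤ y + c → y ≤ z + c → z ≤ w + c → x ≤ w + 3 * c
three-steps {x} {y} {z} {w} {c} x≤ y≤ z≤ = begin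
  x              ≤⟨ x≤ ⟩
  y + c          ≤⟨ +-monoˡ-≤ c y≤ ⟩
  z + c + c      ≤⟨ +-monoˡ-≤ c (+-monoˡ-≤ c z≤) ⟩
  w + c + c + c  ≡⟨ rearrange w c ⟩
  w + 3 * c      ∎
  where
  open ≤-Reasoning
  rearrange : ∀ w c → w + c + c + c ≡ w + 3 * c
  rearrange = solve-∀

search-≤ : ∀ B {Q : ℕ → Set} → (∀ v → Dec (Q v)) → Dec (∃ λ v → v ≤ B × Q v)
search-≤ B {Q} Q? = map′ from to (FinP.any? {suc B} (λ i → Q? (toℕ i)))
  where
  from : (∃ λ (i : Fin (suc B)) → Q (toℕ i)) → ∃ λ v → v ≤ B × Q v
  from (i , q) = toℕ i , toℕ≤pred[n] i , q
  to : (∃ λ v → v ≤ B × Q v) → ∃ λ (i : Fin (suc B)) → Q (toℕ i)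
  to (v , v≤B , q) = fromℕ< (s≤s v≤B) , subst Q (sym (toℕ-fromℕ< (s≤s v≤B))) q

search-bounded : ∀ m (b : Fin m → ℕ) {Q : (Fin m → ℕ) → Set} →
                 (∀ f g → (∀ x → f x ≡ g x) → Q f → Q g) → (∀ f → Dec (Q f)) →
                 Dec (∃ λ f → (∀ x → f x ≤ b x) × Q f)
search-bounded zero b resp Q? with Q? (λ ())
... | yes q = yes ((λ ()) , (λ ()) , q)
... | no ¬q = no λ (f , _ , q) → ¬q (resp f _ (λ ()) q)
search-bounded (suc m) b {Q} resp Q? = map′ from to (search-≤ (b zero) λ v →
    search-bounded m (Vector.tail b) (λ f g f≈g → resp _ _ (cons-cong f≈g)) (λ f → Q? (v Vector.∷ f)))
  where
  cons-cong : ∀ {v f g} → (∀ x → f x ≡ g x) → ∀ x → (v Vector.∷ f) x ≡ (v Vector.∷ g) x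
  cons-cong f≈g zero    = refl
  cons-cong f≈g (suc x) = f≈g x
  Tail : ℕ → Set
  Tail v = ∃ λ f → (∀ x → f x ≤ b (suc x)) × Q (v Vector.∷ f)
  from : (∃ λ v → v ≤ b zero × Tail v) → ∃ λ f → (∀ x → f x ≤ b x) × Q f
  from (v , v≤ , f , f≤ , q) = v Vector.∷ f , (λ { zero → v≤ ; (suc x) → f≤ x }) , q
  to : (∃ λ f → (∀ x → f x ≤ b x) × Q f) → ∃ λ v → v ≤ b zero × Tail v
  to (f , f≤ , q) = Vector.head f , f≤ zero , Vector.tail f , (λ x → f≤ (suc x)) ,
                    resp f _ (λ { zero → refl ; (suc x) → refl }) q

-- Ordered pairs of vertices of W, enumerated by Fin (rk · rk).
pairCount : ℕ → ℕ → ℕ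
pairCount r k = (r * k) * (r * k)

module _ {r k : ℕ} where

  _⊆_ : MultiGraph r k → MultiGraph r k → Set
  G ⊆ F = ∀ u w → mult G u w ≤ mult F u w

  _∖_ : MultiGraph r k → MultiGraph r k → MultiGraph r k
  F ∖ G = record
    { mult = λ u w → mult F u w ∸ mult G u w
    ; msym = λ u w → cong₂ _∸_ (msym F u w) (msym G u w) }

  pairAt : Fin (pairCount r k) → Wtx r k × Wtx r k
  pairAt t = remQuot k (proj₁ (remQuot {r * k} (r * k) t)) , remQuot k (proj₂ (remQuot {r * k} (r * k) t))

  pairIndex : Wtx r k → Wtx r k → Fin (pairCount r k)
  pairIndex (j , i) (j' , i') = combine (combine j i) (combine j' i')

  pairAt-pairIndex : ∀ u w → pairAt (pairIndex u w) ≡ (u , w)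
  pairAt-pairIndex (j , i) (j' , i') =
    trans (cong (λ q → remQuot k (proj₁ q) , remQuot k (proj₂ q))
                (remQuot-combine {r * k} {r * k} (combine j i) (combine j' i')))
          (cong₂ _,_ (remQuot-combine j i) (remQuot-combine j' i'))

  entries : MultiGraph r k → Fin (pairCount r k) → ℕ
  entries F t = uncurry (mult F) (pairAt t)

  entries-pairIndex : ∀ F u w → entries F (pairIndex u w) ≡ mult F u w
  entries-pairIndex F u w = cong (uncurry (mult F)) (pairAt-pairIndex u w)

  -- Every edge is counted twice, once for each orientation.
  weight : MultiGraph r k → ℕ
  weight F = ∑ (pairCount r k) (entries F)

  mult≤weight : ∀ F u w → mult F u w ≤ weight F
  mult≤weight F u w =
    subst (_≤ weight F) (entries-pairIndex F u w) (term≤∑ (pairCount r k) (entries F) (pairIndex u w))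

  weight-mono : ∀ G F → G ⊆ F → weight G ≤ weight F
  weight-mono G F G⊆F = ∑-mono-≤ (pairCount r k) (λ t → G⊆F _ _)

  weight-∖ : ∀ G F → G ⊆ F → weight (F ∖ G) ≡ weight F ∸ weight G
  weight-∖ G F G⊆F = ∑-distrib-∸ (pairCount r k) (entries F) (entries G) (λ t → G⊆F _ _)

  weight-⊊ : ∀ G F → G ⊊ F → weight G < weight F
  weight-⊊ G F (G⊆F , G≉F) = ≤∧≢⇒< (weight-mono G F G⊆F) λ wG≡wF → G≉F λ u w →
    trans (sym (entries-pairIndex G u w))
      (trans (∑-≡⇒≡ (pairCount r k) (entries G) (entries F) (λ t → G⊆F _ _) wG≡wF (pairIndex u w))
             (entries-pairIndex F u w))

  HasEdge⇒weight>0 : ∀ F → HasEdge F → 0 < weight F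
  HasEdge⇒weight>0 F (u , w , 0<m) = <-≤-trans 0<m (mult≤weight F u w)

  weight-∖-< : ∀ G F → G ⊆ F → HasEdge G → weight (F ∖ G) < weight F
  weight-∖-< G F G⊆F edgeG = subst (_< weight F) (sym (weight-∖ G F G⊆F))
    (∸-monoʳ-< (HasEdge⇒weight>0 G edgeG) (weight-mono G F G⊆F))

  ∖-isKrDivisible : ∀ G F → G ⊆ F → IsKrDivisible F → IsKrDivisible G → IsKrDivisible (F ∖ G)
  ∖-isKrDivisible G F G⊆F divF divG = record
    { rpartite  = λ j i₁ i₂ → trans (cong (_∸ mult G (j , i₁) (j , i₂)) (IsKrDivisible.rpartite divF j i₁ i₂))
                                    (0∸n≡0 (mult G (j , i₁) (j , i₂)))
    ; divisible = λ v j₁ j₂ v∉j₁ v∉j₂ →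
        trans (∑-distrib-∸ k _ _ (λ i → G⊆F v (j₁ , i)))
          (trans (cong₂ _∸_ (IsKrDivisible.divisible divF v j₁ j₂ v∉j₁ v∉j₂)
                            (IsKrDivisible.divisible divG v j₁ j₂ v∉j₁ v∉j₂))
                 (sym (∑-distrib-∸ k _ _ (λ i → G⊆F v (j₂ , i))))) }

  IsKrDivisible-cong : ∀ {F G : MultiGraph r k} → (∀ u w → mult F u w ≡ mult G u w) →
                       IsKrDivisible F → IsKrDivisible G
  IsKrDivisible-cong F≈G divF = record
    { rpartite  = λ j i₁ i₂ → trans (sym (F≈G _ _)) (IsKrDivisible.rpartite divF j i₁ i₂)
    ; divisible = λ v j₁ j₂ v∉j₁ v∉j₂ →
        trans (∑-cong k (λ i → sym (F≈G v (j₁ , i))))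
          (trans (IsKrDivisible.divisible divF v j₁ j₂ v∉j₁ v∉j₂) (∑-cong k (λ i → F≈G v (j₂ , i)))) }

  all-Wtx? : {Q : Wtx r k → Set} → (∀ u → Dec (Q u)) → Dec (∀ u → Q u)
  all-Wtx? Q? = map′ (λ h u → h (proj₁ u) (proj₂ u)) (λ h j i → h (j , i))
                     (FinP.all? λ j → FinP.all? λ i → Q? (j , i))

  any-Wtx? : {Q : Wtx r k → Set} → (∀ u → Dec (Q u)) → Dec (∃ Q)
  any-Wtx? Q? = map′ (λ (j , i , q) → (j , i) , q) (λ ((j , i) , q) → j , i , q)
                     (FinP.any? λ j → FinP.any? λ i → Q? (j , i))

  isKrDivisible? : ∀ F → Dec (IsKrDivisible F)
  isKrDivisible? F = map′ (λ (rp , dv) → record { rpartite = rp ; divisible = dv })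
                          (λ divF → IsKrDivisible.rpartite divF , IsKrDivisible.divisible divF)
    (  FinP.all? (λ j → FinP.all? λ i₁ → FinP.all? λ i₂ → mult F (j , i₁) (j , i₂) ≟ 0)
    ×-dec all-Wtx? (λ v → FinP.all? λ j₁ → FinP.all? λ j₂ →
            ¬? (proj₁ v FinP.≟ j₁) →-dec ¬? (proj₁ v FinP.≟ j₂) →-dec mdeg F v j₁ ≟ mdeg F v j₂))

  hasEdge? : ∀ F → Dec (HasEdge F)
  hasEdge? F = any-Wtx? λ u → any-Wtx? λ w → 0 <? mult F u w

  ⊊? : ∀ G F → Dec (G ⊊ F)
  ⊊? G F = all-Wtx? (λ u → all-Wtx? λ w → mult G u w ≤? mult F u w)
           ×-dec ¬? (all-Wtx? λ u → all-Wtx? λ w → mult G u w ≟ mult F u w)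

  Reduction : MultiGraph r k → MultiGraph r k → Set
  Reduction F G = G ⊊ F × HasEdge G × IsKrDivisible G

  reduction? : ∀ F G → Dec (Reduction F G)
  reduction? F G = ⊊? G F ×-dec hasEdge? G ×-dec isKrDivisible? G

  Reduction-cong : ∀ F G G' → (∀ u w → mult G u w ≡ mult G' u w) → Reduction F G → Reduction F G'
  Reduction-cong F G G' G≈G' ((G⊆F , G≉F) , (u , w , 0<m) , divG) =
    ((λ u w → subst (_≤ mult F u w) (G≈G' u w) (G⊆F u w)) ,
     (λ G'≈F → G≉F λ u w → trans (G≈G' u w) (G'≈F u w))) ,
    (u , w , subst (0 <_) (G≈G' u w) 0<m) ,
    IsKrDivisible-cong G≈G' divG

  -- Irreducibility is decided by searching all sub-multigraphs, coded by their entries.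
  reducible? : ∀ F → Dec (∃ (Reduction F))
  reducible? F = map′ (λ (c , _ , s , red) → fromEntries c s , red) to
                      (search-bounded (pairCount r k) (entries F) resp candidate?)
    where
    Symmetric : (Fin (pairCount r k) → ℕ) → Set
    Symmetric c = ∀ u w → c (pairIndex u w) ≡ c (pairIndex w u)
    fromEntries : ∀ c → Symmetric c → MultiGraph r k
    fromEntries c s = record { mult = λ u w → c (pairIndex u w) ; msym = s }
    Candidate : (Fin (pairCount r k) → ℕ) → Set
    Candidate c = Σ (Symmetric c) λ s → Reduction F (fromEntries c s)
    candidate? : ∀ c → Dec (Candidate c)
    candidate? c with all-Wtx? (λ u → all-Wtx? λ w → c (pairIndex u w) ≟ c (pairIndex w u))
    ... | no ¬s = no λ (s , _) → ¬s s
    ... | yes s = map′ (s ,_) (λ (s' , red) → Reduction-cong F (fromEntries c s') (fromEntries c s) (λ _ _ → refl) red)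
                       (reduction? F (fromEntries c s))
    resp : ∀ c c' → (∀ t → c t ≡ c' t) → Candidate c → Candidate c'
    resp c c' c≈c' (s , red) = s' , Reduction-cong F (fromEntries c s) (fromEntries c' s') (λ u w → c≈c' _) red
      where
      s' : Symmetric c'
      s' u w = trans (sym (c≈c' _)) (trans (s u w) (c≈c' _))
    to : ∃ (Reduction F) → ∃ λ c → (∀ t → c t ≤ entries F t) × Candidate c
    to (G , red@((G⊆F , _) , _)) =
      entries G , (λ t → G⊆F _ _) , s ,
      Reduction-cong F G (fromEntries (entries G) s) (λ u w → sym (entries-pairIndex G u w)) red
      where
      s : Symmetric (entries G)
      s u w = trans (entries-pairIndex G u w) (trans (msym G u w) (sym (entries-pairIndex G w u)))

  irreducible-⊆ : ∀ N F → weight F ≤ N → IsKrDivisible F → HasEdge F →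
                  ∃ λ G → G ⊆ F × IsKrDivisible G × HasEdge G × IsIrreducible G
  irreducible-⊆ N F wF≤N divF edgeF with reducible? F
  ... | no irr = F , (λ u w → ≤-refl) , divF , edgeF , λ G G⊊F edgeG divG → irr (G , G⊊F , edgeG , divG)
  irreducible-⊆ zero F wF≤0 _ _ | yes (G , G⊊F , _) = ⊥-elim (n≮0 (<-≤-trans (weight-⊊ G F G⊊F) wF≤0))
  irreducible-⊆ (suc N) F wF≤N _ _ | yes (G , G⊊F@(G⊆F , _) , edgeG , divG)
    with irreducible-⊆ N G (≤-pred (<-≤-trans (weight-⊊ G F G⊊F) wF≤N)) divG edgeG
  ... | I , I⊆G , rest = I , (λ u w → ≤-trans (I⊆G u w) (G⊆F u w)) , rest

  IsIrreducibleDecomposition : MultiGraph r k → List (MultiGraph r k) → Set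
  IsIrreducibleDecomposition F Fs =
    All (λ G → IsKrDivisible G × IsIrreducible G) Fs ×
    (∀ u w → sumList (map (λ G → mult G u w) Fs) ≡ mult F u w)

  irreducibleDecomposition : ∀ F → IsKrDivisible F →
    ∃ λ Fs → IsIrreducibleDecomposition F Fs × length Fs ≤ weight F
  irreducibleDecomposition F divF = go (weight F) F ≤-refl divF
    where
    go : ∀ N F → weight F ≤ N → IsKrDivisible F →
         ∃ λ Fs → IsIrreducibleDecomposition F Fs × length Fs ≤ weight F
    go N F wF≤N divF with hasEdge? F
    ... | no ¬edge = [] , (All.[] , λ u w → sym (n≤0⇒n≡0 (≮⇒≥ λ 0<m → ¬edge (u , w , 0<m)))) , z≤n
    go zero F wF≤0 _ | yes edge = ⊥-elim (n≮0 (<-≤-trans (HasEdge⇒weight>0 F edge) wF≤0))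
    go (suc N) F wF≤N divF | yes edge
      with irreducible-⊆ (weight F) F ≤-refl divF edge
    ... | G , G⊆F , divG , edgeG , irrG
      with go N (F ∖ G) (≤-pred (<-≤-trans (weight-∖-< G F G⊆F edgeG) wF≤N))
              (∖-isKrDivisible G F G⊆F divF divG)
    ... | Fs , (irrFs , sumFs) , |Fs|≤ =
      G ∷ Fs ,
      ((divG , irrG) All.∷ irrFs , λ u w → trans (cong (mult G u w +_) (sumFs u w)) (m+[n∸m]≡n (G⊆F u w))) ,
      ≤-trans (s≤s |Fs|≤) (weight-∖-< G F G⊆F edgeG)

pairCount*3n[pn]≡3p*k²r²n² : ∀ r k n p → pairCount r k * (3 * (n * (p * n))) ≡ 3 * p * (k ^ 2 * r ^ 2 * n ^ 2)
pairCount*3n[pn]≡3p*k²r²n² r k n p = normalise r k n p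
  where
  normalise : ∀ r k n p →
              (r * k) * (r * k) * (3 * (n * (p * n))) ≡ 3 * p * (k * (k * 1) * (r * (r * 1)) * (n * (n * 1)))
  normalise = solve-∀

module EdgeCounts {r n k : ℕ} (H : Graph r n) (P : Vtx r n → Fin k) where

  e : Fin k → Fin r → Fin k → Fin r → ℕ
  e = edgesBetween H P

  inPart : Fin r → Fin n → Fin k → ℕ
  inPart j x i = [ does (P (j , x) FinP.≟ i) ]

  e-as-∑-degPart : ∀ i₁ j₁ i₂ j₂ → e i₁ j₁ i₂ j₂ ≡ ∑ n (λ x → inPart j₁ x i₁ * degPart H P (j₁ , x) i₂ j₂)
  e-as-∑-degPart i₁ j₁ i₂ j₂ = ∑-cong n λ x →
    trans (∑-cong n (λ y → [∧]≡* (does (P (j₁ , x) FinP.≟ i₁)) _))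
          (∑-distribˡ-* n (inPart j₁ x i₁) _)

  e-sym : ∀ i₁ j₁ i₂ j₂ → e i₁ j₁ i₂ j₂ ≡ e i₂ j₂ i₁ j₁
  e-sym i₁ j₁ i₂ j₂ = trans (∑-comm n n _) (∑-cong n λ y → ∑-cong n λ x → cong [_] (begin
    in₁ x ∧ (in₂ y ∧ adj H (j₁ , x) (j₂ , y))   ≡⟨ ∧-swap (in₁ x) (in₂ y) _ ⟩
    in₂ y ∧ (in₁ x ∧ adj H (j₁ , x) (j₂ , y))   ≡⟨ cong (λ b → in₂ y ∧ (in₁ x ∧ b)) (Graph.sym H (j₁ , x) (j₂ , y)) ⟩
    in₂ y ∧ (in₁ x ∧ adj H (j₂ , y) (j₁ , x))   ∎))
    where
    open ≡-Reasoning
    in₁ in₂ : Fin n → Bool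
    in₁ x = does (P (j₁ , x) FinP.≟ i₁)
    in₂ y = does (P (j₂ , y) FinP.≟ i₂)
    ∧-swap : ∀ a b c → a ∧ (b ∧ c) ≡ b ∧ (a ∧ c)
    ∧-swap a b c = trans (sym (∧-assoc a b c)) (trans (cong (_∧ c) (∧-comm a b)) (∧-assoc b a c))

  ∑-degPart : ∀ v j → ∑ k (λ i → degPart H P v i j) ≡ degClass H v j
  ∑-degPart v j = trans (∑-comm k n _) (∑-cong n λ y → ∑-[≟∧] k (P (j , y)) (adj H v (j , y)))

  ∑-e : ∀ i j j' → ∑ k (λ i' → e i j i' j') ≡ ∑ n (λ x → inPart j x i * degClass H (j , x) j')
  ∑-e i j j' = begin
    ∑ k (λ i' → e i j i' j')                                          ≡⟨ ∑-cong k (λ i' → e-as-∑-degPart i j i' j') ⟩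
    ∑ k (λ i' → ∑ n (λ x → inPart j x i * degPart H P (j , x) i' j')) ≡⟨ ∑-comm k n _ ⟩
    ∑ n (λ x → ∑ k (λ i' → inPart j x i * degPart H P (j , x) i' j')) ≡⟨ ∑-cong n (λ x → ∑-distribˡ-* k (inPart j x i) _) ⟩
    ∑ n (λ x → inPart j x i * ∑ k (λ i' → degPart H P (j , x) i' j')) ≡⟨ ∑-cong n (λ x → cong (inPart j x i *_) (∑-degPart (j , x) j')) ⟩
    ∑ n (λ x → inPart j x i * degClass H (j , x) j')                  ∎
    where open ≡-Reasoning

  minE : Fin k → Fin k → ℕ
  minE i₁ i₂ = minOffDiag r (λ j j' → e i₁ j i₂ j')

  minE-≤ : ∀ i₁ i₂ {j₁ j₂} → j₁ ≢ j₂ → minE i₁ i₂ ≤ minE i₂ i₁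
  minE-≤ i₁ i₂ j₁≢j₂ with minOffDiag-attained r (λ j j' → e i₂ j i₁ j') j₁≢j₂
  ... | c , d , c≢d , min≡e = begin
    minE i₁ i₂   ≤⟨ minOffDiag-≤ r (λ j j' → e i₁ j i₂ j') (λ d≡c → c≢d (sym d≡c)) ⟩
    e i₁ d i₂ c  ≡⟨ e-sym i₁ d i₂ c ⟩
    e i₂ c i₁ d  ≡⟨ sym min≡e ⟩
    minE i₂ i₁   ∎
    where open ≤-Reasoning

  emMult-sym : ∀ u w → emMult H P u w ≡ emMult H P w u
  emMult-sym (j₁ , i₁) (j₂ , i₂) with j₁ FinP.≟ j₂ | j₂ FinP.≟ j₁
  ... | yes _      | yes _      = refl
  ... | yes j₁≡j₂  | no j₂≢j₁   = ⊥-elim (j₂≢j₁ (sym j₁≡j₂))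
  ... | no j₁≢j₂   | yes j₂≡j₁  = ⊥-elim (j₁≢j₂ (sym j₂≡j₁))
  ... | no j₁≢j₂   | no _       =
    cong₂ _∸_ (e-sym i₁ j₁ i₂ j₂) (≤-antisym (minE-≤ i₁ i₂ j₁≢j₂) (minE-≤ i₂ i₁ j₁≢j₂))

  excess : MultiGraph r k
  excess = record { mult = emMult H P ; msym = emMult-sym }

  emMult-≢ : ∀ {j₁ j₂} i₁ i₂ → j₁ ≢ j₂ → emMult H P (j₁ , i₁) (j₂ , i₂) ≡ e i₁ j₁ i₂ j₂ ∸ minE i₁ i₂
  emMult-≢ {j₁} {j₂} i₁ i₂ j₁≢j₂ with j₁ FinP.≟ j₂
  ... | yes j₁≡j₂ = ⊥-elim (j₁≢j₂ j₁≡j₂)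
  ... | no _      = refl

  mdeg-excess : ∀ j i j' → j ≢ j' →
    mdeg excess (j , i) j' ≡ ∑ n (λ x → inPart j x i * degClass H (j , x) j') ∸ ∑ k (minE i)
  mdeg-excess j i j' j≢j' = begin
    ∑ k (λ i' → emMult H P (j , i) (j' , i'))  ≡⟨ ∑-cong k (λ i' → emMult-≢ i i' j≢j') ⟩
    ∑ k (λ i' → e i j i' j' ∸ minE i i')       ≡⟨ ∑-distrib-∸ k _ _ (λ i' → minOffDiag-≤ r (λ a b → e i a i' b) j≢j') ⟩
    ∑ k (λ i' → e i j i' j') ∸ ∑ k (minE i)    ≡⟨ cong (_∸ ∑ k (minE i)) (∑-e i j j') ⟩
    ∑ n (λ x → inPart j x i * degClass H (j , x) j') ∸ ∑ k (minE i) ∎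
    where open ≡-Reasoning

  excess-isKrDivisible : IsKrDivisibleGraph H → IsKrDivisible excess
  excess-isKrDivisible divH = record
    { rpartite  = λ j i₁ i₂ → emMult-diagonal j
    ; divisible = λ { (j , i) j₁ j₂ j≢j₁ j≢j₂ → begin
        mdeg excess (j , i) j₁  ≡⟨ mdeg-excess j i j₁ j≢j₁ ⟩
        ∑ n (λ x → inPart j x i * degClass H (j , x) j₁) ∸ ∑ k (minE i)
          ≡⟨ cong (_∸ ∑ k (minE i)) (∑-cong n λ x →
               cong (inPart j x i *_) (IsKrDivisibleGraph.divisible divH (j , x) j₁ j₂ j≢j₁ j≢j₂)) ⟩
        ∑ n (λ x → inPart j x i * degClass H (j , x) j₂) ∸ ∑ k (minE i)
          ≡⟨ sym (mdeg-excess j i j₂ j≢j₂) ⟩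
        mdeg excess (j , i) j₂  ∎ } }
    where
    open ≡-Reasoning
    emMult-diagonal : ∀ {i₁ i₂} j → emMult H P (j , i₁) (j , i₂) ≡ 0
    emMult-diagonal j with j FinP.≟ j
    ... | yes _   = refl
    ... | no j≢j = ⊥-elim (j≢j refl)

  -- The degree hypothesis with γ = p / Q, cleared of denominators.
  module NearlyBalanced (Q p : ℕ)
    (balanced : ∀ i j₁ j₂ (v : Vtx r n) → proj₁ v ≢ j₁ → proj₁ v ≢ j₂ →
                degPart H P v i j₁ * Q ≤ degPart H P v i j₂ * Q + p * n) where

    δ : ℕ
    δ = n * (p * n)

    e-moveʳ : ∀ i₁ i₂ {a b b'} → a ≢ b → a ≢ b' → e i₁ a i₂ b * Q ≤ e i₁ a i₂ b' * Q + δ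
    e-moveʳ i₁ i₂ {a} {b} {b'} a≢b a≢b' = begin
      e i₁ a i₂ b * Q
        ≡⟨ cong (_* Q) (e-as-∑-degPart i₁ a i₂ b) ⟩
      ∑ n (λ x → inPart a x i₁ * d x b) * Q
        ≡⟨ sym (∑-distribʳ-* n Q _) ⟩
      ∑ n (λ x → inPart a x i₁ * d x b * Q)
        ≤⟨ ∑-mono-≤ n (λ x → scale (does (P (a , x) FinP.≟ i₁)) (balanced i₂ b b' (a , x) a≢b a≢b')) ⟩
      ∑ n (λ x → inPart a x i₁ * d x b' * Q + p * n)
        ≡⟨ ∑-distrib-+ n _ _ ⟩
      ∑ n (λ x → inPart a x i₁ * d x b' * Q) + ∑ n (λ _ → p * n)
        ≤⟨ +-mono-≤ (≤-reflexive (∑-distribʳ-* n Q _)) (∑-≤-* n (p * n) (λ _ → ≤-refl)) ⟩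
      ∑ n (λ x → inPart a x i₁ * d x b') * Q + δ
        ≡⟨ cong (λ s → s * Q + δ) (sym (e-as-∑-degPart i₁ a i₂ b')) ⟩
      e i₁ a i₂ b' * Q + δ ∎
      where
      open ≤-Reasoning
      d : Fin n → Fin r → ℕ
      d x j = degPart H P (a , x) i₂ j
      scale : ∀ β {y z} → y * Q ≤ z * Q + p * n → [ β ] * y * Q ≤ [ β ] * z * Q + p * n
      scale true  {y} {z} h = subst₂ (λ y' z' → y' * Q ≤ z' * Q + p * n) (sym (+-identityʳ y)) (sym (+-identityʳ z)) h
      scale false h = z≤n

    e-moveˡ : ∀ i₁ i₂ {a a' b} → a ≢ b → a' ≢ b → e i₁ a i₂ b * Q ≤ e i₁ a' i₂ b * Q + δ
    e-moveˡ i₁ i₂ {a} {a'} {b} a≢b a'≢b =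
      subst₂ (λ x y → x * Q ≤ y * Q + δ) (e-sym i₂ b i₁ a) (e-sym i₂ b i₁ a')
        (e-moveʳ i₂ i₁ (λ b≡a → a≢b (sym b≡a)) (λ b≡a' → a'≢b (sym b≡a')))

    e-move : r ≥ 3 → ∀ i₁ i₂ {a b c d} → a ≢ b → c ≢ d → e i₁ a i₂ b * Q ≤ e i₁ c i₂ d * Q + 3 * δ
    e-move r≥3 i₁ i₂ {a} {b} {c} {d} a≢b c≢d with d FinP.≟ a
    ... | no d≢a = three-steps (e-moveʳ i₁ i₂ a≢b (≢-sym d≢a)) (e-moveˡ i₁ i₂ (≢-sym d≢a) c≢d) (m≤m+n _ δ)
    ... | yes refl with avoid-two r≥3 d c
    ... | f , f≢d , f≢c = three-steps (e-moveʳ i₁ i₂ a≢b (≢-sym f≢d))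
                                      (e-moveˡ i₁ i₂ (≢-sym f≢d) (≢-sym f≢c))
                                      (e-moveʳ i₁ i₂ (≢-sym f≢c) c≢d)

    emMult-bound : r ≥ 3 → ∀ u w → emMult H P u w * Q ≤ 3 * δ
    emMult-bound r≥3 (j₁ , i₁) (j₂ , i₂) with j₁ FinP.≟ j₂
    ... | yes _ = z≤n
    ... | no j₁≢j₂ with minOffDiag-attained r (λ a b → e i₁ a i₂ b) j₁≢j₂
    ... | c , d , c≢d , min≡e = begin
      (e i₁ j₁ i₂ j₂ ∸ minE i₁ i₂) * Q        ≡⟨ *-distribʳ-∸ Q (e i₁ j₁ i₂ j₂) (minE i₁ i₂) ⟩
      e i₁ j₁ i₂ j₂ * Q ∸ minE i₁ i₂ * Q      ≤⟨ m≤n+o⇒m∸n≤o (e i₁ j₁ i₂ j₂ * Q) (minE i₁ i₂ * Q) e≤min+3δ ⟩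
      3 * δ                                   ∎
      where
      open ≤-Reasoning
      e≤min+3δ : e i₁ j₁ i₂ j₂ * Q ≤ minE i₁ i₂ * Q + 3 * δ
      e≤min+3δ = subst (λ m → e i₁ j₁ i₂ j₂ * Q ≤ m * Q + 3 * δ) (sym min≡e) (e-move r≥3 i₁ i₂ j₁≢j₂ c≢d)

    weight-excess : r ≥ 3 → weight excess * Q ≤ pairCount r k * (3 * δ)
    weight-excess r≥3 = begin
      weight excess * Q
        ≡⟨ sym (∑-distribʳ-* (pairCount r k) Q (entries excess)) ⟩
      ∑ (pairCount r k) (λ t → entries excess t * Q)
        ≤⟨ ∑-≤-* (pairCount r k) (3 * δ) (λ t → emMult-bound r≥3 (proj₁ (pairAt t)) (proj₂ (pairAt t))) ⟩
      pairCount r k * (3 * δ) ∎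
      where open ≤-Reasoning

    excess-decomposition : r ≥ 3 → IsKrDivisibleGraph H →
      ∃ λ Fs → IsIrreducibleDecomposition excess Fs × length Fs * Q ≤ 3 * p * (k ^ 2 * r ^ 2 * n ^ 2)
    excess-decomposition r≥3 divH with irreducibleDecomposition excess (excess-isKrDivisible divH)
    ... | Fs , decomposition , |Fs|≤weight = Fs , decomposition , (begin
      length Fs * Q            ≤⟨ *-monoˡ-≤ Q |Fs|≤weight ⟩
      weight excess * Q        ≤⟨ weight-excess r≥3 ⟩
      pairCount r k * (3 * δ)  ≡⟨ pairCount*3n[pn]≡3p*k²r²n² r k n p ⟩
      3 * p * (k ^ 2 * r ^ 2 * n ^ 2) ∎)
      where open ≤-Reasoning

toℚᵘ-ℕ→ℚ : ∀ m → toℚᵘ (ℕ→ℚ m) ℚᵘ.≃ ℚᵘ.mkℚᵘ (ℤ.+ m) 0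
toℚᵘ-ℕ→ℚ m = ℚP.toℚᵘ-fromℚᵘ (ℚᵘ.mkℚᵘ (ℤ.+ m) 0)

module ClearDenominator (p d : ℕ) .(coprime : Coprime p (suc d)) where

  γ : ℚ
  γ = mkℚ (ℤ.+ p) d coprime

  γᵘ : ℚᵘ.ℚᵘ
  γᵘ = ℚᵘ.mkℚᵘ (ℤ.+ p) d

  ℕ→ℚ<γ*ℕ→ℚ⇒ : ∀ a b → ℕ→ℚ a <ℚ γ *ℚ ℕ→ℚ b → a * suc d < p * b
  ℕ→ℚ<γ*ℕ→ℚ⇒ a b a<γb = subst (λ d' → a * suc d' < p * b) (*-identityʳ d)
    (ℤP.drop‿+<+ (subst₂ ℤ._<_ (sym (ℤP.pos-* a (suc (d * 1))))
                               (trans (ℤP.*-identityʳ _) (ℤP.+◃n≡+n (p * b)))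
                               (ℚᵘP.drop-*<* cross)))
    where
    γb≃ : toℚᵘ (γ *ℚ ℕ→ℚ b) ℚᵘ.≃ γᵘ ℚᵘ.* ℚᵘ.mkℚᵘ (ℤ.+ b) 0
    γb≃ = ℚᵘP.≃-trans (ℚP.toℚᵘ-homo-* γ (ℕ→ℚ b)) (ℚᵘP.*-congˡ {γᵘ} (toℚᵘ-ℕ→ℚ b))
    cross : ℚᵘ.mkℚᵘ (ℤ.+ a) 0 ℚᵘ.< γᵘ ℚᵘ.* ℚᵘ.mkℚᵘ (ℤ.+ b) 0
    cross = ℚᵘP.<-respˡ-≃ (toℚᵘ-ℕ→ℚ a) (ℚᵘP.<-respʳ-≃ γb≃ (ℚP.toℚᵘ-mono-< a<γb))

  ∣-∣<γ*ℕ→ℚ⇒≤+ : ∀ x y b → ℕ→ℚ ∣ x - y ∣ <ℚ γ *ℚ ℕ→ℚ b → x * suc d ≤ y * suc d + p * b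
  ∣-∣<γ*ℕ→ℚ⇒≤+ x y b gap = begin
    x * suc d                      ≤⟨ *-monoˡ-≤ (suc d) (m≤n+∣m-n∣ x y) ⟩
    (y + ∣ x - y ∣) * suc d        ≡⟨ *-distribʳ-+ (suc d) y ∣ x - y ∣ ⟩
    y * suc d + ∣ x - y ∣ * suc d  ≤⟨ +-monoʳ-≤ (y * suc d) (<⇒≤ (ℕ→ℚ<γ*ℕ→ℚ⇒ ∣ x - y ∣ b gap)) ⟩
    y * suc d + p * b              ∎
    where open ≤-Reasoning

  ⇒ℕ→ℚ≤c*γ*ℕ→ℚ : ∀ a c b → a * suc d ≤ c * p * b → ℕ→ℚ a ≤ℚ ℕ→ℚ c *ℚ γ *ℚ ℕ→ℚ b
  ⇒ℕ→ℚ≤c*γ*ℕ→ℚ a c b ad≤cpb =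
    ℚP.toℚᵘ-cancel-≤ (ℚᵘP.≤-respˡ-≃ (ℚᵘP.≃-sym (toℚᵘ-ℕ→ℚ a)) (ℚᵘP.≤-respʳ-≃ (ℚᵘP.≃-sym cγb≃) cross))
    where
    cγb≃ : toℚᵘ (ℕ→ℚ c *ℚ γ *ℚ ℕ→ℚ b) ℚᵘ.≃ (ℚᵘ.mkℚᵘ (ℤ.+ c) 0 ℚᵘ.* γᵘ) ℚᵘ.* ℚᵘ.mkℚᵘ (ℤ.+ b) 0
    cγb≃ = ℚᵘP.≃-trans (ℚP.toℚᵘ-homo-* (ℕ→ℚ c *ℚ γ) (ℕ→ℚ b))
             (ℚᵘP.*-cong (ℚᵘP.≃-trans (ℚP.toℚᵘ-homo-* (ℕ→ℚ c) γ) (ℚᵘP.*-congʳ {γᵘ} (toℚᵘ-ℕ→ℚ c))) (toℚᵘ-ℕ→ℚ b))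
    cross : ℚᵘ.mkℚᵘ (ℤ.+ a) 0 ℚᵘ.≤ (ℚᵘ.mkℚᵘ (ℤ.+ c) 0 ℚᵘ.* γᵘ) ℚᵘ.* ℚᵘ.mkℚᵘ (ℤ.+ b) 0
    cross = ℚᵘ.*≤* (subst₂ ℤ._≤_ (ℤP.pos-* a (suc (d + 0) * 1)) cpb≡ (ℤ.+≤+ ad≤cpb'))
      where
      cpb≡ : ℤ.+ (c * p * b) ≡ ((ℤ.+ c ℤ.* ℤ.+ p) ℤ.* ℤ.+ b) ℤ.* ℤ.+ 1
      cpb≡ = trans (trans (ℤP.pos-* (c * p) b) (cong (ℤ._* ℤ.+ b) (ℤP.pos-* c p))) (sym (ℤP.*-identityʳ _))
      ad≤cpb' : a * (suc (d + 0) * 1) ≤ c * p * b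
      ad≤cpb' rewrite +-identityʳ d | *-identityʳ (suc d) = ad≤cpb

proposition10p3 : (r n k : ℕ) → r ≥ 3 → (γ : ℚ) → Positive γ →
    (P : Vtx r n → Fin k) → IsKPartition r n k P →
    (H : Graph r n) → IsKrDivisibleGraph H →
    (∀ (i : Fin k) (j₁ j₂ : Fin r) (v : Vtx r n) → proj₁ v ≢ j₁ → proj₁ v ≢ j₂ →
      ℕ→ℚ ∣ degPart H P v i j₁ - degPart H P v i j₂ ∣ <ℚ γ *ℚ ℕ→ℚ n) →
    Σ (List (MultiGraph r k)) λ Fs →
      All (λ F → IsKrDivisible F × IsIrreducible F) Fs ×
      (∀ (u w : Wtx r k) → sumList (map (λ F → mult F u w) Fs) ≡ emMult H P u w) ×
      (ℕ→ℚ (length Fs) ≤ℚ ℕ→ℚ 3 *ℚ γ *ℚ ℕ→ℚ (k ^ 2 * r ^ 2 * n ^ 2))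
proposition10p3 r n k r≥3 (mkℚ ℤ.-[1+ _ ] _ _) () P _ H divH gap
proposition10p3 r n k r≥3 (mkℚ (ℤ.+ p) d coprime) _ P _ H divH gap =
  Σ.map₂ (λ {Fs} ((irreducible , sums) , bound) → irreducible , sums , ⇒ℕ→ℚ≤c*γ*ℕ→ℚ (length Fs) 3 _ bound)
         (excess-decomposition r≥3 divH)
  where
  open ClearDenominator p d coprime
  open EdgeCounts.NearlyBalanced H P (suc d) p (λ i j₁ j₂ v v∉j₁ v∉j₂ →
    ∣-∣<γ*ℕ→ℚ⇒≤+ (degPart H P v i j₁) (degPart H P v i j₂) n (gap i j₁ j₂ v v∉j₁ v∉j₂))
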